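{- Let $x,y$ be positive integers with $y\mid x$, and let $Q_{y,x}=\{a\in\mathbb{N}: y\mid a \text{ and } a\mid x\}$, ordered by divisibility, with meet $\gcd$ and join $\operatorname{lcm}$. For $a\in Q_{y,x}$ let $\neg a$ denote the local complement of $a$, i.e. the greatest element $c\in Q_{y,x}$ (with respect to divisibility) such that $\gcd(a,c)=y$. Then $Q_{y,x}$ is a Boolean algebra if and only if $\neg a=\dfrac{x\cdot y}{a}$ for every $a\in Q_{y,x}$.
   Context: $Q_{y,x}$ is a finite Heyting algebra with least element $y$ and greatest element $x$; $\neg a$ is its Heyting pseudocomplement. A Boolean algebra means every element $a$ has a complement $c$ with $\gcd(a,c)=y$ and $\operatorname{lcm}(a,c)=x$. -}

module Defs where

open import Data.Nat using (ℕ; _*_)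
open import Data.Nat.Divisibility using (_∣_)
open import Data.Nat.GCD using (gcd)
open import Data.Nat.LCM using (lcm)
open import Data.Product using (_×_; Σ-syntax)
open import Relation.Binary.PropositionalEquality using (_≡_)

InQ : ℕ → ℕ → ℕ → Set
InQ y x a = (y ∣ a) × (a ∣ x)

IsLocalComplement : ℕ → ℕ → ℕ → ℕ → Set
IsLocalComplement y x a c =
  InQ y x c × (gcd a c ≡ y) ×
  (∀ d → InQ y x d → gcd a d ≡ y → d ∣ c)

IsBooleanQ : ℕ → ℕ → Set
IsBooleanQ y x =
  ∀ a → InQ y x a → Σ[ c ∈ ℕ ] (InQ y x c × (gcd a c ≡ y) × (lcm a c ≡ x))

{-# OPTIONS --safe #-}
module Submission where

-- The elements c of Q_{y,x} with gcd(a,c) = y form a family of divisors of x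
-- that contains y and is closed under lcm (writing a = a'y, c = c'y, the
-- condition says a' is coprime to c'), so the lcm of the whole family is its
-- greatest element: the local complement ¬a always exists. As
-- gcd(a,¬a)·lcm(a,¬a) = a·¬a and gcd(a,¬a) = y, the identity ¬a·a = x·y says
-- exactly that ¬a is a complement of a. And if Q_{y,x} is Boolean, any
-- complement c of a divides ¬a, so x = lcm(a,c) ∣ lcm(a,¬a) ∣ x.

open import Defs
open import Data.List using (_∷_; foldr; filter; upTo)
open import Data.List.Membership.Propositional using (_∈_)
open import Data.List.Membership.Propositional.Properties using (∈-filter⁺; ∈-upTo⁺)
open import Data.List.Properties using (foldr-preservesᵇ)
open import Data.List.Relation.Unary.All.Properties using (all-filter)
open import Data.List.Relation.Unary.Any using (here; there)
open import Data.Nat using (ℕ; _+_; _*_; _≤_; s≤s; NonZero; _≟_)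
open import Data.Nat.Coprimality using (Coprime; GCD≡1⇒coprime; coprime-divisor; coprime-factors)
open import Data.Nat.Divisibility
  using (_∣_; divides; _∣?_; ∣-refl; ∣-trans; ∣-antisym; ∣⇒≤; m∣m*n; n∣m*n; *-monoˡ-∣)
open import Data.Nat.GCD using (gcd; GCD; gcd-GCD; GCD-*; gcd[m,n]∣m; gcd[m,n]∣n; gcd-greatest)
open import Data.Nat.LCM using (lcm; m∣lcm[m,n]; n∣lcm[m,n]; lcm-least; gcd*lcm)
open import Data.Nat.Properties using (*-comm; *-identityˡ; *-cancelʳ-≡)
open import Data.Product using (_×_; _,_; Σ-syntax)
open import Function.Bundles using (_⇔_; mk⇔; Equivalence)
open import Relation.Binary.PropositionalEquality using (_≡_; refl; sym; trans; cong; subst; module ≡-Reasoning)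
open import Relation.Nullary.Decidable using (_×-dec_)
open import Relation.Unary using (Pred; Decidable)

private
  variable
    a c d l m n o x y : ℕ

coprime-*ʳ : Coprime m n → Coprime m o → Coprime m (n * o)
coprime-*ʳ {n = n} m⊥n m⊥o {i} (i∣m , i∣n*o) = m⊥o (i∣m , coprime-divisor i⊥n i∣n*o)
  where
  i⊥n : Coprime i n
  i⊥n (j∣i , j∣n) = m⊥n (∣-trans j∣i i∣m , j∣n)

gcd[m*d,n*d]≡d⇒coprime : ∀ m n → .{{NonZero d}} → gcd (m * d) (n * d) ≡ d → Coprime m n
gcd[m*d,n*d]≡d⇒coprime {d = d} m n eq = GCD≡1⇒coprime (GCD-* gcd≡1*d)
  where
  gcd≡1*d : GCD (m * d) (n * d) (1 * d)
  gcd≡1*d = subst (GCD (m * d) (n * d)) (trans eq (sym (*-identityˡ d))) (gcd-GCD _ _)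

gcd[m,n]≡d⇒gcd[m,o]≡d⇒gcd[m,lcm[n,o]]≡d :
  ∀ m n o → .{{NonZero d}} → gcd m n ≡ d → gcd m o ≡ d → gcd m (lcm n o) ≡ d
gcd[m,n]≡d⇒gcd[m,o]≡d⇒gcd[m,lcm[n,o]]≡d {d = d} m n o eq₁ eq₂
  with subst (_∣ m) eq₁ (gcd[m,n]∣m m n)
     | subst (_∣ n) eq₁ (gcd[m,n]∣n m n)
     | subst (_∣ o) eq₂ (gcd[m,n]∣n m o)
... | d∣m@(divides m′ refl) | d∣n@(divides n′ refl) | divides o′ refl =
  ∣-antisym (coprime-factors m′⊥n′o′ (gcd[m,n]∣m (m′ * d) lcm′ ,
                                      ∣-trans (gcd[m,n]∣n (m′ * d) lcm′) lcm′∣n′o′d))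
            (gcd-greatest d∣m (∣-trans d∣n (m∣lcm[m,n] _ _)))
  where
  m′⊥n′o′ : Coprime m′ (n′ * o′)
  m′⊥n′o′ = coprime-*ʳ (gcd[m*d,n*d]≡d⇒coprime m′ n′ eq₁)
                       (gcd[m*d,n*d]≡d⇒coprime m′ o′ eq₂)

  lcm′ : ℕ
  lcm′ = lcm (n′ * d) (o′ * d)

  lcm′∣n′o′d : lcm′ ∣ n′ * o′ * d
  lcm′∣n′o′d = lcm-least (*-monoˡ-∣ d (m∣m*n {n′} o′)) (*-monoˡ-∣ d (n∣m*n n′ {o′}))

∈⇒∣foldr-lcm : ∀ {e xs} → n ∈ xs → n ∣ foldr lcm e xs
∈⇒∣foldr-lcm (here refl) = m∣lcm[m,n] _ _
∈⇒∣foldr-lcm {xs = m ∷ _} (there n∈xs) = ∣-trans (∈⇒∣foldr-lcm n∈xs) (n∣lcm[m,n] m _)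

module _ {p} {P : Pred ℕ p} (P? : Decidable P)
         (lcm-closed : ∀ {m n} → P m → P n → P (lcm m n)) where

  lcm-closed⇒∃greatest : (∀ {m} → P m → m ≤ n) → P m →
                         Σ[ g ∈ ℕ ] P g × (∀ {o} → P o → o ∣ g)
  lcm-closed⇒∃greatest {n = n} {m = m} bounded Pm =
    foldr lcm m (filter P? (upTo (1 + n))) ,
    foldr-preservesᵇ lcm-closed Pm (all-filter P? (upTo (1 + n))) ,
    λ Po → ∈⇒∣foldr-lcm (∈-filter⁺ P? (∈-upTo⁺ (s≤s (bounded Po))) Po)

localComplement-exists : .{{NonZero x}} → .{{NonZero y}} → y ∣ x → y ∣ a →
                         Σ[ c ∈ ℕ ] IsLocalComplement y x a c
localComplement-exists {x = x} {y = y} {a = a} y∣x y∣a =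
  greatest⇒localComplement (lcm-closed⇒∃greatest P? lcm-closed bounded (y∈Q , gcd[a,y]≡y))
  where
  P : Pred ℕ _
  P c = InQ y x c × (gcd a c ≡ y)

  greatest⇒localComplement : Σ[ c ∈ ℕ ] P c × (∀ {d} → P d → d ∣ c) →
                             Σ[ c ∈ ℕ ] IsLocalComplement y x a c
  greatest⇒localComplement (c , (c∈Q , gcd≡y) , greatest) =
    c , c∈Q , gcd≡y , λ d d∈Q gcd[a,d]≡y → greatest (d∈Q , gcd[a,d]≡y)

  P? : Decidable P
  P? c = ((y ∣? c) ×-dec (c ∣? x)) ×-dec (gcd a c ≟ y)

  lcm-closed : ∀ {m n} → P m → P n → P (lcm m n)
  lcm-closed ((y∣m , m∣x) , gcd₁) ((_ , n∣x) , gcd₂) =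
    (∣-trans y∣m (m∣lcm[m,n] _ _) , lcm-least m∣x n∣x) ,
    gcd[m,n]≡d⇒gcd[m,o]≡d⇒gcd[m,lcm[n,o]]≡d a _ _ gcd₁ gcd₂

  bounded : ∀ {m} → P m → m ≤ x
  bounded ((_ , m∣x) , _) = ∣⇒≤ m∣x

  y∈Q : InQ y x y
  y∈Q = ∣-refl , y∣x

  gcd[a,y]≡y : gcd a y ≡ y
  gcd[a,y]≡y = ∣-antisym (gcd[m,n]∣n a y) (gcd-greatest y∣a ∣-refl)

lcm[m,n]≡l⇔n*m≡l*d : ∀ m n → .{{NonZero d}} → gcd m n ≡ d → lcm m n ≡ l ⇔ n * m ≡ l * d
lcm[m,n]≡l⇔n*m≡l*d {d = d} {l = l} m n gcd≡d = mk⇔ to from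
  where
  open ≡-Reasoning

  n*m≡d*lcm : n * m ≡ d * lcm m n
  n*m≡d*lcm = begin
    n * m                ≡⟨ *-comm n m ⟩
    m * n                ≡⟨ sym (gcd*lcm m n) ⟩
    gcd m n * lcm m n    ≡⟨ cong (_* lcm m n) gcd≡d ⟩
    d * lcm m n          ∎

  to : lcm m n ≡ l → n * m ≡ l * d
  to lcm≡l = trans n*m≡d*lcm (trans (cong (d *_) lcm≡l) (*-comm d l))

  from : n * m ≡ l * d → lcm m n ≡ l
  from n*m≡l*d = *-cancelʳ-≡ (lcm m n) l d (begin
    lcm m n * d          ≡⟨ *-comm (lcm m n) d ⟩
    d * lcm m n          ≡⟨ sym n*m≡d*lcm ⟩
    n * m                ≡⟨ n*m≡l*d ⟩
    l * d                ∎)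

IsBooleanQ⇒lcm[a,¬a]≡x : IsBooleanQ y x → InQ y x a → IsLocalComplement y x a c → lcm a c ≡ x
IsBooleanQ⇒lcm[a,¬a]≡x {a = a} {c = c} boolean a∈Q@(_ , a∣x) ((_ , c∣x) , _ , greatest)
  with c′ , c′∈Q , gcd[a,c′]≡y , lcm[a,c′]≡x ← boolean a a∈Q
  = ∣-antisym (lcm-least a∣x c∣x)
              (subst (_∣ lcm a c) lcm[a,c′]≡x
                     (lcm-least (m∣lcm[m,n] a c)
                                (∣-trans (greatest c′ c′∈Q gcd[a,c′]≡y) (n∣lcm[m,n] a c))))

corollary2 : (x y : ℕ) → NonZero x → NonZero y → y ∣ x →
    IsBooleanQ y x ⇔
      (∀ a c → InQ y x a → IsLocalComplement y x a c → c * a ≡ x * y)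
corollary2 x y x≢0 y≢0 y∣x = mk⇔ to from
  where
  to : IsBooleanQ y x → ∀ a c → InQ y x a → IsLocalComplement y x a c → c * a ≡ x * y
  to boolean a c a∈Q ¬a@(_ , gcd≡y , _) =
    Equivalence.to (lcm[m,n]≡l⇔n*m≡l*d a c {{y≢0}} gcd≡y)
                   (IsBooleanQ⇒lcm[a,¬a]≡x boolean a∈Q ¬a)

  from : (∀ a c → InQ y x a → IsLocalComplement y x a c → c * a ≡ x * y) → IsBooleanQ y x
  from product a a∈Q@(y∣a , _)
    with c , ¬a@(c∈Q , gcd≡y , _) ← localComplement-exists {{x≢0}} {{y≢0}} y∣x y∣a
    = c , c∈Q , gcd≡y ,
      Equivalence.from (lcm[m,n]≡l⇔n*m≡l*d a c {{y≢0}} gcd≡y) (product a c a∈Q ¬a)
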